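{- Let $K$ be an imaginary quadratic number field with ring of integers $\mathcal{O}_K$. If $\{a,b,c,d\}\subseteq\mathcal{O}_K$ is a Diophantine quadruple with $2\leqslant|a|\leqslant|b|\leqslant|c|\leqslant|d|$, then $|d|\geqslant\frac{|ab|}{8}\geqslant\frac{|a|^2}{8}$.
   Context: A Diophantine quadruple in $\mathcal{O}_K$ is a set of four distinct elements of $\mathcal{O}_K$ such that the product of any two distinct elements plus one is a perfect square in $\mathcal{O}_K$. -}

module Defs where

open import Data.Nat as ℕ using (ℕ; suc; _%_; _/_)
open import Data.Nat.Divisibility using (_∣_)
open import Data.Integer using (ℤ; +_; _+_; _-_; _*_)
open import Data.Product using (_×_; _,_; ∃)
open import Relation.Binary.PropositionalEquality using (_≡_; _≢_)

SquareFree : ℕ → Set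
SquareFree m = ∀ (k : ℕ) → (k ℕ.* k) ∣ m → k ≡ 1

-- K = ℚ(√-m), m squarefree, m ≥ 1.  O_K = ℤ[ω] with ω² = t·ω - n, where
--   m ≡ 3 (mod 4):  ω = (1 + √-m)/2,  t = 1, n = (m+1)/4
--   otherwise    :  ω = √-m,           t = 0, n = m
traceω : ℕ → ℤ
traceω m with m % 4
... | 3 = + 1
... | _ = + 0

normω : ℕ → ℤ
normω m with m % 4
... | 3 = + ((suc m) / 4)
... | _ = + m

-- An element x + y·ω of O_K is represented by the pair (x , y).
OK : Set
OK = ℤ × ℤ

oneO : OK
oneO = (+ 1 , + 0)

addO : OK → OK → OK
addO (a , b) (c , d) = (a + c , b + d)

mulO : ℕ → OK → OK → OK
mulO m (a , b) (c , d) =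
  (a * c - normω m * (b * d) , a * d + b * c + traceω m * (b * d))

-- Field norm N(x + yω) = x² + t x y + n y² = |x + yω|² (complex absolute value squared).
NormO : ℕ → OK → ℤ
NormO m (x , y) = x * x + traceω m * (x * y) + normω m * (y * y)

IsSquareO : ℕ → OK → Set
IsSquareO m z = ∃ λ w → mulO m w w ≡ z

DProp : ℕ → OK → OK → Set
DProp m u v = IsSquareO m (addO (mulO m u v) oneO)

DiophantineQuadruple : ℕ → OK → OK → OK → OK → Set
DiophantineQuadruple m a b c d =
  (a ≢ b × a ≢ c × a ≢ d × b ≢ c × b ≢ d × c ≢ d) ×
  (DProp m a b × DProp m a c × DProp m a d ×
   DProp m b c × DProp m b d × DProp m c d)

-- For a Diophantine triple {a, b, c} with ab + 1 = r², ac + 1 = x², bc + 1 = y², put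
-- σ = a + b + c + 2abc and δ = (c - a - b)² - 4(ab + 1).  Then σ² - 4(rxy)² = δ, so
-- δ = (σ - 2rxy)(σ + 2rxy).  The norm N is multiplicative and N ≥ 1 away from 0, so if
-- δ ≠ 0 then N(σ) ≤ N(δ) = O(N(c)²); but σ - (a + b + c) = 2abc makes N(σ) of order
-- N(a)N(b)N(c).  With explicit constants this is impossible once N(a)N(b) > 64 N(c), so
-- then δ = 0: the triple is regular.  If the quadruple violated the bound, all four
-- sub-triples would be regular: c and d are then the two roots, c + d = 2(a + b), of
-- δ(a, b, -) = 0, and regularity of {a, c, d} and {b, c, d} forces b = -a and 5a² = 4,
-- which has no solution since N(5a²) = 25 N(a)² ≠ 16.
module Submission where

open import Defs
open import Data.Nat as ℕ using (ℕ; suc)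
open import Data.Integer as ℤ using (ℤ; +_; +[1+_])
open import Data.Product using (∃; _,_; proj₁; proj₂)
open import Relation.Binary.PropositionalEquality

module QuadraticRing (t n : ℤ) where

  open import Data.Integer using (_+_; _-_; -_; _*_; +0; +-*-rawRing)
  open import Data.Integer.Solver using (module +-*-Solver)
  open import Data.Product using (_×_)
  import Data.Integer.Properties as ℤ
  import Data.Maybe as Maybe
  open import Relation.Nullary.Decidable.Core using (dec⇒maybe)
  open import Level using (0ℓ)
  open import Algebra.Bundles using (CommutativeRing)
  open import Algebra.Structures {A = OK} _≡_ using (IsCommutativeRing)
  open import Algebra.Consequences.Propositional
    using (comm∧idˡ⇒id; comm∧invˡ⇒inv; comm∧distrʳ⇒distrˡ)
  open import Algebra.Solver.Ring.AlmostCommutativeRing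
    using (fromCommutativeRing; _-Raw-AlmostCommutative⟶_)
  import Algebra.Solver.Ring

  infixl 6 _+ᵒ_ _-ᵒ_
  infixl 7 _*ᵒ_
  infix 8 -ᵒ_

  0ᵒ 1ᵒ : OK
  0ᵒ = (+0 , +0)
  1ᵒ = oneO

  ι : ℤ → OK
  ι c = (c , +0)

  norm : OK → ℤ
  norm (x , y) = x * x + t * (x * y) + n * (y * y)

  -- Opaque so that the ring solver below compares normal forms without unfolding them
  -- into integer components, which would be prohibitively slow.
  opaque
    _+ᵒ_ : OK → OK → OK
    _+ᵒ_ = addO

    -ᵒ_ : OK → OK
    -ᵒ (x , y) = (- x , - y)

    _*ᵒ_ : OK → OK → OK
    (a , b) *ᵒ (c , d) = (a * c - n * (b * d) , a * d + b * c + t * (b * d))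

  _-ᵒ_ : OK → OK → OK
  u -ᵒ v = u +ᵒ -ᵒ v

  module ComponentwiseIdentities where
    open +-*-Solver using (solve; _:=_; Polynomial; con; _:+_; _:-_; _:*_; :-_)

    private
      :mul : ∀ {k} → (t n : Polynomial k) → Polynomial k × Polynomial k → Polynomial k × Polynomial k →
             Polynomial k × Polynomial k
      :mul t n (a , b) (c , d) = (a :* c :- n :* (b :* d) , a :* d :+ b :* c :+ t :* (b :* d))

      :norm : ∀ {k} → (t n : Polynomial k) → Polynomial k × Polynomial k → Polynomial k
      :norm t n (x , y) = x :* x :+ t :* (x :* y) :+ n :* (y :* y)

      :ι : ∀ {k} → Polynomial k → Polynomial k × Polynomial k
      :ι c = (c , con (+ 0))

      :neg : ∀ {k} → Polynomial k × Polynomial k → Polynomial k × Polynomial k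
      :neg (x , y) = (:- x , :- y)

      :add : ∀ {k} → Polynomial k × Polynomial k → Polynomial k × Polynomial k →
             Polynomial k × Polynomial k
      :add (a , b) (c , d) = (a :+ c , b :+ d)

    opaque
      unfolding _+ᵒ_ -ᵒ_ _*ᵒ_

      +ᵒ-assoc : ∀ u v w → (u +ᵒ v) +ᵒ w ≡ u +ᵒ (v +ᵒ w)
      +ᵒ-assoc (a , b) (c , d) (e , f) = cong₂ _,_ (ℤ.+-assoc a c e) (ℤ.+-assoc b d f)

      +ᵒ-comm : ∀ u v → u +ᵒ v ≡ v +ᵒ u
      +ᵒ-comm (a , b) (c , d) = cong₂ _,_ (ℤ.+-comm a c) (ℤ.+-comm b d)

      +ᵒ-identityˡ : ∀ u → 0ᵒ +ᵒ u ≡ u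
      +ᵒ-identityˡ (a , b) = cong₂ _,_ (ℤ.+-identityˡ a) (ℤ.+-identityˡ b)

      +ᵒ-inverseˡ : ∀ u → -ᵒ u +ᵒ u ≡ 0ᵒ
      +ᵒ-inverseˡ (a , b) = cong₂ _,_ (ℤ.+-inverseˡ a) (ℤ.+-inverseˡ b)

      *ᵒ-assoc : ∀ u v w → (u *ᵒ v) *ᵒ w ≡ u *ᵒ (v *ᵒ w)
      *ᵒ-assoc (a , b) (c , d) (e , f) = cong₂ _,_
        (solve 8 (λ a b c d e f t n → proj₁ (:mul t n (:mul t n (a , b) (c , d)) (e , f))
                                   := proj₁ (:mul t n (a , b) (:mul t n (c , d) (e , f))))
                refl a b c d e f t n)
        (solve 8 (λ a b c d e f t n → proj₂ (:mul t n (:mul t n (a , b) (c , d)) (e , f))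
                                   := proj₂ (:mul t n (a , b) (:mul t n (c , d) (e , f))))
                refl a b c d e f t n)

      *ᵒ-comm : ∀ u v → u *ᵒ v ≡ v *ᵒ u
      *ᵒ-comm (a , b) (c , d) = cong₂ _,_
        (solve 6 (λ a b c d t n → proj₁ (:mul t n (a , b) (c , d)) := proj₁ (:mul t n (c , d) (a , b)))
                refl a b c d t n)
        (solve 6 (λ a b c d t n → proj₂ (:mul t n (a , b) (c , d)) := proj₂ (:mul t n (c , d) (a , b)))
                refl a b c d t n)

      *ᵒ-identityˡ : ∀ u → 1ᵒ *ᵒ u ≡ u
      *ᵒ-identityˡ (a , b) = cong₂ _,_
        (solve 4 (λ a b t n → proj₁ (:mul t n (:ι (con (+ 1))) (a , b)) := a) refl a b t n)
        (solve 4 (λ a b t n → proj₂ (:mul t n (:ι (con (+ 1))) (a , b)) := b) refl a b t n)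

      *ᵒ-distribʳ-+ᵒ : ∀ u v w → (v +ᵒ w) *ᵒ u ≡ v *ᵒ u +ᵒ w *ᵒ u
      *ᵒ-distribʳ-+ᵒ (a , b) (c , d) (e , f) = cong₂ _,_
        (solve 8 (λ a b c d e f t n → proj₁ (:mul t n (:add (c , d) (e , f)) (a , b))
                                   := proj₁ (:add (:mul t n (c , d) (a , b)) (:mul t n (e , f) (a , b))))
                refl a b c d e f t n)
        (solve 8 (λ a b c d e f t n → proj₂ (:mul t n (:add (c , d) (e , f)) (a , b))
                                   := proj₂ (:add (:mul t n (c , d) (a , b)) (:mul t n (e , f) (a , b))))
                refl a b c d e f t n)

      ι-add : ∀ x y → ι (x + y) ≡ ι x +ᵒ ι y
      ι-add x y = refl

      ι-neg : ∀ x → ι (- x) ≡ -ᵒ ι x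
      ι-neg x = refl

      ι-mul : ∀ x y → ι (x * y) ≡ ι x *ᵒ ι y
      ι-mul x y = cong₂ _,_
        (solve 4 (λ x y t n → x :* y := proj₁ (:mul t n (:ι x) (:ι y))) refl x y t n)
        (solve 4 (λ x y t n → con (+ 0) := proj₂ (:mul t n (:ι x) (:ι y))) refl x y t n)

      +ᵒ-definition : ∀ u v → u +ᵒ v ≡ addO u v
      +ᵒ-definition u v = refl

      *ᵒ-definition : ∀ u v → u *ᵒ v ≡ (proj₁ u * proj₁ v - n * (proj₂ u * proj₂ v) ,
                                        proj₁ u * proj₂ v + proj₂ u * proj₁ v + t * (proj₂ u * proj₂ v))
      *ᵒ-definition u v = refl

      norm-*ᵒ : ∀ u v → norm (u *ᵒ v) ≡ norm u * norm v
      norm-*ᵒ (a , b) (c , d) = solve 6 (λ a b c d t n →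
        :norm t n (:mul t n (a , b) (c , d)) := :norm t n (a , b) :* :norm t n (c , d)) refl a b c d t n

      norm-neg : ∀ u → norm (-ᵒ u) ≡ norm u
      norm-neg (a , b) = solve 4 (λ a b t n → :norm t n (:neg (a , b)) := :norm t n (a , b)) refl a b t n

      norm-weighted-parallelogram : ∀ p q u v →
        p * q * norm (u +ᵒ v) + norm (ι p *ᵒ u -ᵒ ι q *ᵒ v) ≡ p * (p + q) * norm u + q * (p + q) * norm v
      norm-weighted-parallelogram p q (a , b) (c , d) = solve 8 (λ p q a b c d t n →
        p :* q :* :norm t n (:add (a , b) (c , d))
          :+ :norm t n (:add (:mul t n (:ι p) (a , b)) (:neg (:mul t n (:ι q) (c , d))))
        := p :* (p :+ q) :* :norm t n (a , b) :+ q :* (p :+ q) :* :norm t n (c , d))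
        refl p q a b c d t n

    norm-ι : ∀ c → norm (ι c) ≡ c * c
    norm-ι c = solve 3 (λ c t n → :norm t n (:ι c) := c :* c) refl c t n

    4*norm≡completed-square : ∀ x y →
      + 4 * norm (x , y) ≡ (+ 2 * x + t * y) * (+ 2 * x + t * y) + (+ 4 * n - t * t) * (y * y)
    4*norm≡completed-square x y = solve 4 (λ x y t n →
      con (+ 4) :* :norm t n (x , y)
        := (con (+ 2) :* x :+ t :* y) :* (con (+ 2) :* x :+ t :* y) :+ (con (+ 4) :* n :- t :* t) :* (y :* y))
      refl x y t n

  open ComponentwiseIdentities public

  isCommutativeRing : IsCommutativeRing _+ᵒ_ _*ᵒ_ -ᵒ_ 0ᵒ 1ᵒ
  isCommutativeRing = record
    { isRing = record
      { +-isAbelianGroup = record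
        { isGroup = record
          { isMonoid = record
            { isSemigroup = record
              { isMagma = record { isEquivalence = isEquivalence ; ∙-cong = cong₂ _+ᵒ_ }
              ; assoc = +ᵒ-assoc }
            ; identity = comm∧idˡ⇒id +ᵒ-comm +ᵒ-identityˡ }
          ; inverse = comm∧invˡ⇒inv +ᵒ-comm +ᵒ-inverseˡ
          ; ⁻¹-cong = cong (λ u → -ᵒ u) }
        ; comm = +ᵒ-comm }
      ; *-cong = cong₂ _*ᵒ_
      ; *-assoc = *ᵒ-assoc
      ; *-identity = comm∧idˡ⇒id *ᵒ-comm *ᵒ-identityˡ
      ; distrib = comm∧distrʳ⇒distrˡ *ᵒ-comm *ᵒ-distribʳ-+ᵒ , *ᵒ-distribʳ-+ᵒ }
    ; *-comm = *ᵒ-comm }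

  commutativeRing : CommutativeRing 0ℓ 0ℓ
  commutativeRing = record { isCommutativeRing = isCommutativeRing }

  ι-homomorphism : +-*-rawRing -Raw-AlmostCommutative⟶ fromCommutativeRing commutativeRing
  ι-homomorphism = record
    { ⟦_⟧ = ι
    ; +-homo = ι-add
    ; *-homo = ι-mul
    ; -‿homo = ι-neg
    ; 0-homo = refl
    ; 1-homo = refl }

  module Solver = Algebra.Solver.Ring +-*-rawRing (fromCommutativeRing commutativeRing)
    ι-homomorphism (λ x y → Maybe.map (cong ι) (dec⇒maybe (x ℤ.≟ y)))
  open Solver using (solve; Polynomial; _:=_; con; _:+_; _:-_; _:*_; :-_)

  IsSquare : OK → Set
  IsSquare u = ∃ λ w → w *ᵒ w ≡ u

  IsDiophantinePair : OK → OK → Set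
  IsDiophantinePair u v = IsSquare (u *ᵒ v +ᵒ 1ᵒ)

  defect : OK → OK → OK → OK
  defect a b c = (c -ᵒ (a +ᵒ b)) *ᵒ (c -ᵒ (a +ᵒ b)) -ᵒ ι (+ 4) *ᵒ (a *ᵒ b +ᵒ 1ᵒ)

  IsRegular : OK → OK → OK → Set
  IsRegular a b c = defect a b c ≡ 0ᵒ

  private
    :defect : ∀ {k} → Polynomial k → Polynomial k → Polynomial k → Polynomial k
    :defect a b c = (c :- (a :+ b)) :* (c :- (a :+ b)) :- con (+ 4) :* (a :* b :+ con (+ 1))

  σ : OK → OK → OK → OK
  σ a b c = a +ᵒ b +ᵒ c +ᵒ ι (+ 2) *ᵒ a *ᵒ b *ᵒ c

  defect-factorisation : ∀ {a b c r x y} →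
    r *ᵒ r ≡ a *ᵒ b +ᵒ 1ᵒ → x *ᵒ x ≡ a *ᵒ c +ᵒ 1ᵒ → y *ᵒ y ≡ b *ᵒ c +ᵒ 1ᵒ →
    defect a b c ≡ (σ a b c -ᵒ ι (+ 2) *ᵒ (r *ᵒ x *ᵒ y)) *ᵒ (σ a b c +ᵒ ι (+ 2) *ᵒ (r *ᵒ x *ᵒ y))
  defect-factorisation {a} {b} {c} {r} {x} {y} r² x² y² = begin
    defect a b c
      ≡⟨ solve 3 (λ a b c → :defect a b c := :σ a b c :* :σ a b c :- con (+ 4) :*
                   ((a :* b :+ con (+ 1)) :* (a :* c :+ con (+ 1)) :* (b :* c :+ con (+ 1))))
               refl a b c ⟩
    σ a b c *ᵒ σ a b c -ᵒ ι (+ 4) *ᵒ ((a *ᵒ b +ᵒ 1ᵒ) *ᵒ (a *ᵒ c +ᵒ 1ᵒ) *ᵒ (b *ᵒ c +ᵒ 1ᵒ))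
      ≡⟨ cong (λ z → σ a b c *ᵒ σ a b c -ᵒ ι (+ 4) *ᵒ z) (cong₂ _*ᵒ_ (cong₂ _*ᵒ_ r² x²) y²) ⟨
    σ a b c *ᵒ σ a b c -ᵒ ι (+ 4) *ᵒ ((r *ᵒ r) *ᵒ (x *ᵒ x) *ᵒ (y *ᵒ y))
      ≡⟨ solve 4 (λ s r x y → s :* s :- con (+ 4) :* ((r :* r) :* (x :* x) :* (y :* y)) :=
                   (s :- con (+ 2) :* (r :* x :* y)) :* (s :+ con (+ 2) :* (r :* x :* y)))
               refl (σ a b c) r x y ⟩
    (σ a b c -ᵒ ι (+ 2) *ᵒ (r *ᵒ x *ᵒ y)) *ᵒ (σ a b c +ᵒ ι (+ 2) *ᵒ (r *ᵒ x *ᵒ y)) ∎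
    where
    open ≡-Reasoning
    :σ : ∀ {k} → Polynomial k → Polynomial k → Polynomial k → Polynomial k
    :σ a b c = a :+ b :+ c :+ con (+ 2) :* a :* b :* c

  2*ᵒ≡difference+sum : ∀ u v → ι (+ 2) *ᵒ u ≡ (u -ᵒ v) +ᵒ (u +ᵒ v)
  2*ᵒ≡difference+sum = solve 2 (λ u v → con (+ 2) :* u := (u :- v) :+ (u :+ v)) refl

  2abc≡σ-[a+b+c] : ∀ a b c → ι (+ 2) *ᵒ a *ᵒ b *ᵒ c ≡ σ a b c -ᵒ (a +ᵒ b +ᵒ c)
  2abc≡σ-[a+b+c] = solve 3 (λ a b c →
    con (+ 2) :* a :* b :* c := (a :+ b :+ c :+ con (+ 2) :* a :* b :* c) :- (a :+ b :+ c)) refl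

  defect-sym : ∀ a b c → defect a b c ≡ defect b a c
  defect-sym = solve 3 (λ a b c → :defect a b c := :defect b a c) refl

  -- For fixed a, b the defect is a monic quadratic in c whose two roots sum to 2(a + b).
  defect-difference : ∀ a b c d →
    (d -ᵒ c) *ᵒ (c -ᵒ (ι (+ 2) *ᵒ (a +ᵒ b) -ᵒ d)) ≡ defect a b d -ᵒ defect a b c
  defect-difference = solve 4 (λ a b c d →
    (d :- c) :* (c :- (con (+ 2) :* (a :+ b) :- d)) := :defect a b d :- :defect a b c) refl

  defect-conjugate : ∀ a b d →
    ι (+ 3) *ᵒ (a *ᵒ a -ᵒ ι (+ 4) *ᵒ a *ᵒ b -ᵒ ι (+ 4))
      ≡ ι (+ 4) *ᵒ defect a b d -ᵒ defect a (ι (+ 2) *ᵒ (a +ᵒ b) -ᵒ d) d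
  defect-conjugate = solve 3 (λ a b d →
    con (+ 3) :* (a :* a :- con (+ 4) :* a :* b :- con (+ 4))
      := con (+ 4) :* :defect a b d :- :defect a (con (+ 2) :* (a :+ b) :- d) d) refl

  difference-of-squares : ∀ a b →
    (a -ᵒ b) *ᵒ (a +ᵒ b)
      ≡ (a *ᵒ a -ᵒ ι (+ 4) *ᵒ a *ᵒ b -ᵒ ι (+ 4)) -ᵒ (b *ᵒ b -ᵒ ι (+ 4) *ᵒ b *ᵒ a -ᵒ ι (+ 4))
  difference-of-squares = solve 2 (λ a b →
    (a :- b) :* (a :+ b)
      := (a :* a :- con (+ 4) :* a :* b :- con (+ 4)) :- (b :* b :- con (+ 4) :* b :* a :- con (+ 4)))
    refl

  5a²-4≡ : ∀ a → ι (+ 5) *ᵒ (a *ᵒ a) -ᵒ ι (+ 4) ≡ a *ᵒ a -ᵒ ι (+ 4) *ᵒ a *ᵒ (-ᵒ a) -ᵒ ι (+ 4)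
  5a²-4≡ = solve 1 (λ a →
    con (+ 5) :* (a :* a) :- con (+ 4) := a :* a :- con (+ 4) :* a :* (:- a) :- con (+ 4)) refl

module _ where
  open import Data.Nat
  open import Data.Nat.Properties
  open import Data.Nat.Tactic.RingSolver using (solve)
  open import Data.List using (_∷_; [])
  open import Data.Empty using (⊥)

  large-gap-absurd : ∀ {P c} → P ≤ c * c → 64 * c < P →
    12 * P * c ≤ 405 * (c * c) + 340 * P + 5440 + 108 * c → ⊥
  large-gap-absurd {P} {c} P≤c² 64c<P hyp = <-irrefl refl (begin-strict
    405 * (c * c) + 343 * P                        ≡⟨ solve (P ∷ c ∷ []) ⟩
    405 * (c * c) + 325 * P + 18 * P               <⟨ +-monoʳ-< (405 * (c * c) + 325 * P) 18P<43c² ⟩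
    405 * (c * c) + 325 * P + 43 * (c * c)         ≡⟨ solve (P ∷ c ∷ []) ⟩
    7 * (64 * c * c) + 5 * (65 * P)                ≤⟨ +-mono-≤ (*-monoʳ-≤ 7 64c²≤Pc) (*-monoʳ-≤ 5 65P≤Pc) ⟩
    7 * (P * c) + 5 * (P * c)                      ≡⟨ solve (P ∷ c ∷ []) ⟩
    12 * P * c                                     ≤⟨ hyp ⟩
    405 * (c * c) + 340 * P + 5440 + 108 * c       ≡⟨ solve (P ∷ c ∷ []) ⟩
    405 * (c * c) + 340 * P + (5440 + 108 * c)     ≤⟨ +-monoʳ-≤ (405 * (c * c) + 340 * P) 5440+108c≤3P ⟩
    405 * (c * c) + 340 * P + 3 * P                ≡⟨ solve (P ∷ c ∷ []) ⟩
    405 * (c * c) + 343 * P                        ∎)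
    where
    open ≤-Reasoning
    64<c : 64 < c
    64<c = *-cancelʳ-< c 64 c (<-≤-trans 64c<P P≤c²)
    64c²≤Pc : 64 * c * c ≤ P * c
    64c²≤Pc = *-monoˡ-≤ c (<⇒≤ 64c<P)
    65P≤Pc : 65 * P ≤ P * c
    65P≤Pc = subst (_≤ P * c) (*-comm P 65) (*-monoʳ-≤ P 64<c)
    18P<43c² : 18 * P < 43 * (c * c)
    18P<43c² = <-≤-trans (*-monoˡ-< P {{>-nonZero (≤-<-trans z≤n 64c<P)}} (≤ᵇ⇒≤ 19 43 _))
                         (*-monoʳ-≤ 43 P≤c²)
    5440+108c≤3P : 5440 + 108 * c ≤ 3 * P
    5440+108c≤3P = begin
      5440 + 108 * c   ≤⟨ +-monoˡ-≤ (108 * c) (≤-trans (≤ᵇ⇒≤ 5440 5460 _) (*-monoʳ-≤ 84 64<c)) ⟩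
      84 * c + 108 * c ≡⟨ solve (c ∷ []) ⟩
      3 * (64 * c)     ≤⟨ *-monoʳ-≤ 3 (<⇒≤ 64c<P) ⟩
      3 * P            ∎

module PositiveDefinite (t n : ℤ) (k : ℕ) (disc : + 4 ℤ.* n ℤ.- t ℤ.* t ≡ +[1+ k ]) where

  open QuadraticRing t n
  open import Data.Nat
  open import Data.Nat.Properties
  open import Data.Nat.Tactic.RingSolver using (solve; solve-∀)
  open import Data.List using (_∷_; [])
  open import Data.Integer using (∣_∣; -[1+_])
  import Data.Integer.Properties as ℤ
  open import Data.Product.Properties using (≡-dec)
  open import Data.Sum as Sum using (_⊎_)
  open import Data.Empty using (⊥; ⊥-elim)
  open import Function using (_∘_; id)
  open import Relation.Nullary using (¬_)
  open import Relation.Nullary.Decidable using (decidable-stable)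
  open import Algebra.Bundles using (CommutativeRing)
  open CommutativeRing commutativeRing using (zeroˡ; zeroʳ)
  open import Algebra.Properties.Group (CommutativeRing.+-group commutativeRing)
    using (x∙y⁻¹≈ε⇒x≈y; x≈y⇒x∙y⁻¹≈ε; inverseʳ-unique)

  square≡+∣∣² : ∀ i → i ℤ.* i ≡ + (∣ i ∣ * ∣ i ∣)
  square≡+∣∣² (+ m)    = sym (ℤ.pos-* m m)
  square≡+∣∣² -[1+ m ] = refl

  m*m≡0⇒m≡0 : ∀ {m} → m * m ≡ 0 → m ≡ 0
  m*m≡0⇒m≡0 {zero} _ = refl

  i*i≡0⇒i≡0 : ∀ i → i ℤ.* i ≡ + 0 → i ≡ + 0
  i*i≡0⇒i≡0 i i²≡0 = ℤ.∣i∣≡0⇒i≡0 (m*m≡0⇒m≡0 (ℤ.+-injective (trans (sym (square≡+∣∣² i)) i²≡0)))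

  4*norm≡+sum-of-squares : ∀ x y → let s = + 2 ℤ.* x ℤ.+ t ℤ.* y in
    + 4 ℤ.* norm (x , y) ≡ + (∣ s ∣ * ∣ s ∣ + suc k * (∣ y ∣ * ∣ y ∣))
  4*norm≡+sum-of-squares x y = begin
    + 4 ℤ.* norm (x , y)
      ≡⟨ 4*norm≡completed-square x y ⟩
    s ℤ.* s ℤ.+ (+ 4 ℤ.* n ℤ.- t ℤ.* t) ℤ.* (y ℤ.* y)
      ≡⟨ cong₂ ℤ._+_ (square≡+∣∣² s) (cong₂ ℤ._*_ disc (square≡+∣∣² y)) ⟩
    + (∣ s ∣ * ∣ s ∣) ℤ.+ +[1+ k ] ℤ.* + (∣ y ∣ * ∣ y ∣)
      ≡⟨ cong (λ z → + (∣ s ∣ * ∣ s ∣) ℤ.+ z) (ℤ.pos-* (suc k) _) ⟨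
    + (∣ s ∣ * ∣ s ∣) ℤ.+ + (suc k * (∣ y ∣ * ∣ y ∣))
      ≡⟨ ℤ.pos-+ (∣ s ∣ * ∣ s ∣) (suc k * (∣ y ∣ * ∣ y ∣)) ⟨
    + (∣ s ∣ * ∣ s ∣ + suc k * (∣ y ∣ * ∣ y ∣)) ∎
    where
    open ≡-Reasoning
    s : ℤ
    s = + 2 ℤ.* x ℤ.+ t ℤ.* y

  ‖_‖ : OK → ℕ
  ‖ u ‖ = ∣ norm u ∣

  norm≡+‖‖ : ∀ u → norm u ≡ + ‖ u ‖
  norm≡+‖‖ (x , y) with norm (x , y) | 4*norm≡+sum-of-squares x y
  ... | + _      | _  = refl
  ... | -[1+ _ ] | ()

  ‖‖≡0⇒≡0ᵒ : ∀ u → ‖ u ‖ ≡ 0 → u ≡ 0ᵒ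
  ‖‖≡0⇒≡0ᵒ (x , y) ‖u‖≡0 = cong₂ _,_ x≡0 y≡0
    where
    s : ℤ
    s = + 2 ℤ.* x ℤ.+ t ℤ.* y
    norm≡0 : norm (x , y) ≡ + 0
    norm≡0 = trans (norm≡+‖‖ (x , y)) (cong +_ ‖u‖≡0)
    squares≡0 : ∣ s ∣ * ∣ s ∣ + suc k * (∣ y ∣ * ∣ y ∣) ≡ 0
    squares≡0 = ℤ.+-injective (trans (sym (4*norm≡+sum-of-squares x y)) (cong (λ z → + 4 ℤ.* z) norm≡0))
    y≡0 : y ≡ + 0
    y≡0 = ℤ.∣i∣≡0⇒i≡0 (m*m≡0⇒m≡0 (m*n≡0⇒m≡0 (∣ y ∣ * ∣ y ∣) (suc k)
            (trans (*-comm (∣ y ∣ * ∣ y ∣) (suc k)) (m+n≡0⇒n≡0 (∣ s ∣ * ∣ s ∣) squares≡0))))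
    x≡0 : x ≡ + 0
    x≡0 = i*i≡0⇒i≡0 x (trans (sym (norm-ι x)) (trans (cong (λ y → norm (x , y)) (sym y≡0)) norm≡0))

  ‖*ᵒ‖ : ∀ u v → ‖ u *ᵒ v ‖ ≡ ‖ u ‖ * ‖ v ‖
  ‖*ᵒ‖ u v = trans (cong ∣_∣ (norm-*ᵒ u v)) (ℤ.abs-* (norm u) (norm v))

  ‖-ᵒ‖ : ∀ u → ‖ -ᵒ u ‖ ≡ ‖ u ‖
  ‖-ᵒ‖ u = cong ∣_∣ (norm-neg u)

  ‖ι‖ : ∀ c → ‖ ι c ‖ ≡ ∣ c ∣ * ∣ c ∣
  ‖ι‖ c = trans (cong ∣_∣ (norm-ι c)) (ℤ.abs-* c c)

  ‖‖-nonZero : ∀ {u} → u ≢ 0ᵒ → NonZero ‖ u ‖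
  ‖‖-nonZero {u} u≢0 = ≢-nonZero (u≢0 ∘ ‖‖≡0⇒≡0ᵒ u)

  u*ᵒv≡0⇒u≡0∨v≡0 : ∀ u v → u *ᵒ v ≡ 0ᵒ → u ≡ 0ᵒ ⊎ v ≡ 0ᵒ
  u*ᵒv≡0⇒u≡0∨v≡0 u v uv≡0 = Sum.map (‖‖≡0⇒≡0ᵒ u) (‖‖≡0⇒≡0ᵒ v)
    (m*n≡0⇒m≡0∨n≡0 ‖ u ‖ (trans (sym (‖*ᵒ‖ u v)) (trans (cong ‖_‖ uv≡0) (‖ι‖ (+ 0)))))

  *ᵒ-cancelˡ-≡0ᵒ : ∀ {u v} → u ≢ 0ᵒ → u *ᵒ v ≡ 0ᵒ → v ≡ 0ᵒ
  *ᵒ-cancelˡ-≡0ᵒ {u} {v} u≢0 uv≡0 = Sum.[ ⊥-elim ∘ u≢0 , id ] (u*ᵒv≡0⇒u≡0∨v≡0 u v uv≡0)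

  weighted-triangle : ∀ p q u v → p * q * ‖ u +ᵒ v ‖ ≤ p * (p + q) * ‖ u ‖ + q * (p + q) * ‖ v ‖
  weighted-triangle p q u v = subst (p * q * ‖ u +ᵒ v ‖ ≤_) weighted-sum (m≤m+n _ ‖ w ‖)
    where
    open ≡-Reasoning
    w : OK
    w = ι (+ p) *ᵒ u -ᵒ ι (+ q) *ᵒ v
    +[l*m*o] : ∀ l m o → + (l * m * o) ≡ + l ℤ.* + m ℤ.* + o
    +[l*m*o] l m o = trans (ℤ.pos-* (l * m) o) (cong (λ z → z ℤ.* + o) (ℤ.pos-* l m))
    weighted-sum : p * q * ‖ u +ᵒ v ‖ + ‖ w ‖ ≡ p * (p + q) * ‖ u ‖ + q * (p + q) * ‖ v ‖
    weighted-sum = ℤ.+-injective (begin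
      + (p * q * ‖ u +ᵒ v ‖ + ‖ w ‖)
        ≡⟨ trans (ℤ.pos-+ (p * q * ‖ u +ᵒ v ‖) ‖ w ‖) (cong (λ z → z ℤ.+ + ‖ w ‖) (+[l*m*o] p q _)) ⟩
      + p ℤ.* + q ℤ.* + ‖ u +ᵒ v ‖ ℤ.+ + ‖ w ‖
        ≡⟨ cong₂ (λ x y → + p ℤ.* + q ℤ.* x ℤ.+ y) (norm≡+‖‖ (u +ᵒ v)) (norm≡+‖‖ w) ⟨
      + p ℤ.* + q ℤ.* norm (u +ᵒ v) ℤ.+ norm w
        ≡⟨ norm-weighted-parallelogram (+ p) (+ q) u v ⟩
      + p ℤ.* + (p + q) ℤ.* norm u ℤ.+ + q ℤ.* + (p + q) ℤ.* norm v
        ≡⟨ cong₂ (λ x y → + p ℤ.* + (p + q) ℤ.* x ℤ.+ + q ℤ.* + (p + q) ℤ.* y) (norm≡+‖‖ u) (norm≡+‖‖ v) ⟩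
      + p ℤ.* + (p + q) ℤ.* + ‖ u ‖ ℤ.+ + q ℤ.* + (p + q) ℤ.* + ‖ v ‖
        ≡⟨ trans (ℤ.pos-+ (p * (p + q) * ‖ u ‖) (q * (p + q) * ‖ v ‖))
                 (cong₂ ℤ._+_ (+[l*m*o] p (p + q) _) (+[l*m*o] q (p + q) _)) ⟨
      + (p * (p + q) * ‖ u ‖ + q * (p + q) * ‖ v ‖) ∎)

  ‖+ᵒ‖≤2‖‖+2‖‖ : ∀ u v → ‖ u +ᵒ v ‖ ≤ 2 * ‖ u ‖ + 2 * ‖ v ‖
  ‖+ᵒ‖≤2‖‖+2‖‖ u v =
    subst (_≤ 2 * ‖ u ‖ + 2 * ‖ v ‖) (+-identityʳ ‖ u +ᵒ v ‖) (weighted-triangle 1 1 u v)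

  ‖+ᵒ‖≤9* : ∀ {u v m} → ‖ u ‖ ≤ 4 * m → ‖ v ‖ ≤ m → ‖ u +ᵒ v ‖ ≤ 9 * m
  ‖+ᵒ‖≤9* {u} {v} {m} u≤4m v≤m = *-cancelˡ-≤ 2 (begin
    2 * ‖ u +ᵒ v ‖        ≤⟨ weighted-triangle 1 2 u v ⟩
    3 * ‖ u ‖ + 6 * ‖ v ‖ ≤⟨ +-mono-≤ (*-monoʳ-≤ 3 u≤4m) (*-monoʳ-≤ 6 v≤m) ⟩
    3 * (4 * m) + 6 * m   ≡⟨ solve (m ∷ []) ⟩
    2 * (9 * m)           ∎)
    where open ≤-Reasoning

  ‖+ᵒ‖≤4‖*ᵒ‖ : ∀ {u v} → u ≢ 0ᵒ → v ≢ 0ᵒ → ‖ u +ᵒ v ‖ ≤ 4 * ‖ u *ᵒ v ‖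
  ‖+ᵒ‖≤4‖*ᵒ‖ {u} {v} u≢0 v≢0 = begin
    ‖ u +ᵒ v ‖                    ≤⟨ ‖+ᵒ‖≤2‖‖+2‖‖ u v ⟩
    2 * ‖ u ‖ + 2 * ‖ v ‖         ≤⟨ +-mono-≤ (*-monoʳ-≤ 2 u≤uv) (*-monoʳ-≤ 2 v≤uv) ⟩
    2 * ‖ u *ᵒ v ‖ + 2 * ‖ u *ᵒ v ‖ ≡⟨ *-distribʳ-+ ‖ u *ᵒ v ‖ 2 2 ⟨
    4 * ‖ u *ᵒ v ‖                ∎
    where
    open ≤-Reasoning
    u≤uv : ‖ u ‖ ≤ ‖ u *ᵒ v ‖
    u≤uv = subst (‖ u ‖ ≤_) (sym (‖*ᵒ‖ u v)) (m≤m*n (‖ u ‖) (‖ v ‖) {{‖‖-nonZero v≢0}})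
    v≤uv : ‖ v ‖ ≤ ‖ u *ᵒ v ‖
    v≤uv = subst (‖ v ‖ ≤_) (sym (‖*ᵒ‖ u v)) (m≤n*m (‖ v ‖) (‖ u ‖) {{‖‖-nonZero u≢0}})

  module _ {a b c : OK} (a≤c : ‖ a ‖ ≤ ‖ c ‖) (b≤c : ‖ b ‖ ≤ ‖ c ‖) where

    ‖a+b‖≤4‖c‖ : ‖ a +ᵒ b ‖ ≤ 4 * ‖ c ‖
    ‖a+b‖≤4‖c‖ = begin
      ‖ a +ᵒ b ‖            ≤⟨ ‖+ᵒ‖≤2‖‖+2‖‖ a b ⟩
      2 * ‖ a ‖ + 2 * ‖ b ‖ ≤⟨ +-mono-≤ (*-monoʳ-≤ 2 a≤c) (*-monoʳ-≤ 2 b≤c) ⟩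
      2 * ‖ c ‖ + 2 * ‖ c ‖ ≡⟨ *-distribʳ-+ ‖ c ‖ 2 2 ⟨
      4 * ‖ c ‖             ∎
      where open ≤-Reasoning

    4‖defect‖≤ : 4 * ‖ defect a b c ‖ ≤ 405 * (‖ c ‖ * ‖ c ‖) + 340 * (‖ a ‖ * ‖ b ‖) + 5440
    4‖defect‖≤ = begin
      4 * ‖ defect a b c ‖
        ≤⟨ weighted-triangle 1 4 (e *ᵒ e) (-ᵒ (ι (+ 4) *ᵒ (a *ᵒ b +ᵒ 1ᵒ))) ⟩
      5 * ‖ e *ᵒ e ‖ + 20 * ‖ -ᵒ (ι (+ 4) *ᵒ (a *ᵒ b +ᵒ 1ᵒ)) ‖
        ≡⟨ cong₂ (λ x y → 5 * x + 20 * y) (‖*ᵒ‖ e e)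
                 (trans (‖-ᵒ‖ _) (trans (‖*ᵒ‖ (ι (+ 4)) _) (cong (_* ‖ a *ᵒ b +ᵒ 1ᵒ ‖) (‖ι‖ (+ 4))))) ⟩
      5 * (‖ e ‖ * ‖ e ‖) + 20 * (16 * ‖ a *ᵒ b +ᵒ 1ᵒ ‖)
        ≤⟨ +-mono-≤ (*-monoʳ-≤ 5 (*-mono-≤ e≤9c e≤9c)) (*-monoʳ-≤ 20 16‖ab+1‖≤) ⟩
      5 * (9 * ‖ c ‖ * (9 * ‖ c ‖)) + 20 * (17 * (‖ a ‖ * ‖ b ‖) + 272)
        ≡⟨ arithmetic ‖ c ‖ (‖ a ‖ * ‖ b ‖) ⟩
      405 * (‖ c ‖ * ‖ c ‖) + 340 * (‖ a ‖ * ‖ b ‖) + 5440 ∎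
      where
      open ≤-Reasoning
      e : OK
      e = c -ᵒ (a +ᵒ b)
      e≤9c : ‖ e ‖ ≤ 9 * ‖ c ‖
      e≤9c = subst (_≤ 9 * ‖ c ‖) (cong ‖_‖ (+ᵒ-comm (-ᵒ (a +ᵒ b)) c))
               (‖+ᵒ‖≤9* (subst (_≤ 4 * ‖ c ‖) (sym (‖-ᵒ‖ (a +ᵒ b))) ‖a+b‖≤4‖c‖) ≤-refl)
      16‖ab+1‖≤ : 16 * ‖ a *ᵒ b +ᵒ 1ᵒ ‖ ≤ 17 * (‖ a ‖ * ‖ b ‖) + 272
      16‖ab+1‖≤ = subst₂ (λ x y → 16 * ‖ a *ᵒ b +ᵒ 1ᵒ ‖ ≤ 17 * x + 272 * y) (‖*ᵒ‖ a b) (‖ι‖ (+ 1))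
                    (weighted-triangle 1 16 (a *ᵒ b) 1ᵒ)
      arithmetic : ∀ C P → 5 * (9 * C * (9 * C)) + 20 * (17 * P + 272) ≡ 405 * (C * C) + 340 * P + 5440
      arithmetic = solve-∀

    12‖a‖‖b‖‖c‖≤ : 12 * (‖ a ‖ * ‖ b ‖) * ‖ c ‖ ≤ 4 * ‖ σ a b c ‖ + 108 * ‖ c ‖
    12‖a‖‖b‖‖c‖≤ = begin
      12 * (‖ a ‖ * ‖ b ‖) * ‖ c ‖           ≡⟨ arithmetic (‖ a ‖) (‖ b ‖) (‖ c ‖) ⟩
      3 * (4 * ‖ a ‖ * ‖ b ‖ * ‖ c ‖)         ≡⟨ cong (λ z → 3 * z) ‖2abc‖ ⟨
      3 * ‖ ι (+ 2) *ᵒ a *ᵒ b *ᵒ c ‖          ≡⟨ cong (λ z → 3 * ‖ z ‖) (2abc≡σ-[a+b+c] a b c) ⟩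
      3 * ‖ σ a b c -ᵒ (a +ᵒ b +ᵒ c) ‖        ≤⟨ weighted-triangle 1 3 (σ a b c) (-ᵒ (a +ᵒ b +ᵒ c)) ⟩
      4 * ‖ σ a b c ‖ + 12 * ‖ -ᵒ (a +ᵒ b +ᵒ c) ‖ ≡⟨ cong (λ z → 4 * ‖ σ a b c ‖ + 12 * z) (‖-ᵒ‖ _) ⟩
      4 * ‖ σ a b c ‖ + 12 * ‖ a +ᵒ b +ᵒ c ‖  ≤⟨ +-monoʳ-≤ (4 * ‖ σ a b c ‖)
                                                   (*-monoʳ-≤ 12 (‖+ᵒ‖≤9* ‖a+b‖≤4‖c‖ ≤-refl)) ⟩
      4 * ‖ σ a b c ‖ + 12 * (9 * ‖ c ‖)      ≡⟨ cong (λ z → 4 * ‖ σ a b c ‖ + z) (*-assoc 12 9 ‖ c ‖) ⟨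
      4 * ‖ σ a b c ‖ + 108 * ‖ c ‖           ∎
      where
      open ≤-Reasoning
      ‖2abc‖ : ‖ ι (+ 2) *ᵒ a *ᵒ b *ᵒ c ‖ ≡ 4 * ‖ a ‖ * ‖ b ‖ * ‖ c ‖
      ‖2abc‖ = trans (‖*ᵒ‖ _ c) (cong (_* ‖ c ‖) (trans (‖*ᵒ‖ _ b) (cong (_* ‖ b ‖)
                 (trans (‖*ᵒ‖ (ι (+ 2)) a) (cong (_* ‖ a ‖) (‖ι‖ (+ 2)))))))
      arithmetic : ∀ A B C → 12 * (A * B) * C ≡ 3 * (4 * A * B * C)
      arithmetic = solve-∀

  ‖σ‖≤‖defect‖ : ∀ {a b c} → IsDiophantinePair a b → IsDiophantinePair a c → IsDiophantinePair b c →
    ¬ IsRegular a b c → ‖ σ a b c ‖ ≤ ‖ defect a b c ‖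
  ‖σ‖≤‖defect‖ {a} {b} {c} (r , r²) (x , x²) (y , y²) irregular = *-cancelˡ-≤ 4 (begin
    4 * ‖ σ a b c ‖          ≡⟨ trans (‖*ᵒ‖ (ι (+ 2)) (σ a b c)) (cong (_* ‖ σ a b c ‖) (‖ι‖ (+ 2))) ⟨
    ‖ ι (+ 2) *ᵒ σ a b c ‖   ≡⟨ cong ‖_‖ (2*ᵒ≡difference+sum (σ a b c) v) ⟩
    ‖ e₋ +ᵒ e₊ ‖             ≤⟨ ‖+ᵒ‖≤4‖*ᵒ‖ e₋≢0 e₊≢0 ⟩
    4 * ‖ e₋ *ᵒ e₊ ‖         ≡⟨ cong (λ z → 4 * ‖ z ‖) defect≡e₋e₊ ⟨
    4 * ‖ defect a b c ‖     ∎)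
    where
    open ≤-Reasoning
    v e₋ e₊ : OK
    v = ι (+ 2) *ᵒ (r *ᵒ x *ᵒ y)
    e₋ = σ a b c -ᵒ v
    e₊ = σ a b c +ᵒ v
    defect≡e₋e₊ : defect a b c ≡ e₋ *ᵒ e₊
    defect≡e₋e₊ = defect-factorisation r² x² y²
    e₋≢0 : e₋ ≢ 0ᵒ
    e₋≢0 e₋≡0 = irregular (trans defect≡e₋e₊ (trans (cong (_*ᵒ e₊) e₋≡0) (zeroˡ e₊)))
    e₊≢0 : e₊ ≢ 0ᵒ
    e₊≢0 e₊≡0 = irregular (trans defect≡e₋e₊ (trans (cong (e₋ *ᵒ_) e₊≡0) (zeroʳ e₋)))

  diophantine-triple-regular : ∀ {a b c} → ‖ a ‖ ≤ ‖ c ‖ → ‖ b ‖ ≤ ‖ c ‖ →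
    64 * ‖ c ‖ < ‖ a ‖ * ‖ b ‖ →
    IsDiophantinePair a b → IsDiophantinePair a c → IsDiophantinePair b c → IsRegular a b c
  diophantine-triple-regular {a} {b} {c} a≤c b≤c gap ab ac bc =
    decidable-stable (≡-dec ℤ._≟_ ℤ._≟_ (defect a b c) 0ᵒ) λ irregular →
      large-gap-absurd (*-mono-≤ a≤c b≤c) gap (begin
        12 * (‖ a ‖ * ‖ b ‖) * ‖ c ‖
          ≤⟨ 12‖a‖‖b‖‖c‖≤ a≤c b≤c ⟩
        4 * ‖ σ a b c ‖ + 108 * ‖ c ‖
          ≤⟨ +-monoˡ-≤ (108 * ‖ c ‖) (*-monoʳ-≤ 4 (‖σ‖≤‖defect‖ ab ac bc irregular)) ⟩
        4 * ‖ defect a b c ‖ + 108 * ‖ c ‖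
          ≤⟨ +-monoˡ-≤ (108 * ‖ c ‖) (4‖defect‖≤ a≤c b≤c) ⟩
        405 * (‖ c ‖ * ‖ c ‖) + 340 * (‖ a ‖ * ‖ b ‖) + 5440 + 108 * ‖ c ‖ ∎)
    where open ≤-Reasoning

  regular-other-root : ∀ {a b c d} → IsRegular a b c → IsRegular a b d → c ≢ d →
    c ≡ ι (+ 2) *ᵒ (a +ᵒ b) -ᵒ d
  regular-other-root {a} {b} {c} {d} abc abd c≢d =
    x∙y⁻¹≈ε⇒x≈y c _ (*ᵒ-cancelˡ-≡0ᵒ d-c≢0
      (trans (defect-difference a b c d) (x≈y⇒x∙y⁻¹≈ε (trans abd (sym abc)))))
    where
    d-c≢0 : d -ᵒ c ≢ 0ᵒ
    d-c≢0 = c≢d ∘ sym ∘ x∙y⁻¹≈ε⇒x≈y d c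

  regular-conjugate : ∀ {a b d} → IsRegular a b d → IsRegular a (ι (+ 2) *ᵒ (a +ᵒ b) -ᵒ d) d →
    a *ᵒ a -ᵒ ι (+ 4) *ᵒ a *ᵒ b -ᵒ ι (+ 4) ≡ 0ᵒ
  regular-conjugate {a} {b} {d} abd ac′d = *ᵒ-cancelˡ-≡0ᵒ (λ ())
    (trans (defect-conjugate a b d)
      (x≈y⇒x∙y⁻¹≈ε (trans (cong (ι (+ 4) *ᵒ_) abd) (trans (zeroʳ (ι (+ 4))) (sym ac′d)))))

  5a²≢4 : ∀ a → ι (+ 5) *ᵒ (a *ᵒ a) ≢ ι (+ 4)
  5a²≢4 a 5a²≡4 = 25*m≢16 (‖ a ‖ * ‖ a ‖) (begin
    25 * (‖ a ‖ * ‖ a ‖)      ≡⟨ cong₂ _*_ (‖ι‖ (+ 5)) (‖*ᵒ‖ a a) ⟨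
    ‖ ι (+ 5) ‖ * ‖ a *ᵒ a ‖  ≡⟨ ‖*ᵒ‖ (ι (+ 5)) (a *ᵒ a) ⟨
    ‖ ι (+ 5) *ᵒ (a *ᵒ a) ‖   ≡⟨ cong ‖_‖ 5a²≡4 ⟩
    ‖ ι (+ 4) ‖               ≡⟨ ‖ι‖ (+ 4) ⟩
    16                        ∎)
    where
    open ≡-Reasoning
    25*m≢16 : ∀ m → 25 * m ≢ 16
    25*m≢16 (suc m) 25m≡16 = <⇒≱ (≤ᵇ⇒≤ 17 25 _) (subst (25 ≤_) 25m≡16 (m≤m*n 25 (suc m)))

  regular-quadruple-absurd : ∀ {a b c d} → a ≢ b → c ≢ d →
    IsRegular a b c → IsRegular a b d → IsRegular a c d → IsRegular b c d → ⊥
  regular-quadruple-absurd {a} {b} {c} {d} a≢b c≢d abc abd acd bcd = 5a²≢4 a 5a²≡4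
    where
    c≡c′ : c ≡ ι (+ 2) *ᵒ (a +ᵒ b) -ᵒ d
    c≡c′ = regular-other-root abc abd c≢d
    a-root : a *ᵒ a -ᵒ ι (+ 4) *ᵒ a *ᵒ b -ᵒ ι (+ 4) ≡ 0ᵒ
    a-root = regular-conjugate abd (subst (λ z → IsRegular a z d) c≡c′ acd)
    b-root : b *ᵒ b -ᵒ ι (+ 4) *ᵒ b *ᵒ a -ᵒ ι (+ 4) ≡ 0ᵒ
    b-root = regular-conjugate (trans (defect-sym b a d) abd)
      (subst (λ z → IsRegular b z d) (trans c≡c′ (cong (λ s → ι (+ 2) *ᵒ s -ᵒ d) (+ᵒ-comm a b))) bcd)
    a+b≡0 : a +ᵒ b ≡ 0ᵒ
    a+b≡0 = *ᵒ-cancelˡ-≡0ᵒ (a≢b ∘ x∙y⁻¹≈ε⇒x≈y a b)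
      (trans (difference-of-squares a b) (x≈y⇒x∙y⁻¹≈ε (trans a-root (sym b-root))))
    5a²≡4 : ι (+ 5) *ᵒ (a *ᵒ a) ≡ ι (+ 4)
    5a²≡4 = x∙y⁻¹≈ε⇒x≈y _ _ (trans (5a²-4≡ a)
      (subst (λ z → a *ᵒ a -ᵒ ι (+ 4) *ᵒ a *ᵒ z -ᵒ ι (+ 4) ≡ 0ᵒ) (inverseʳ-unique a b a+b≡0) a-root))

  norm≤norm⇒‖‖≤‖‖ : ∀ u v → norm u ℤ.≤ norm v → ‖ u ‖ ≤ ‖ v ‖
  norm≤norm⇒‖‖≤‖‖ u v u≤v = ℤ.drop‿+≤+ (subst₂ ℤ._≤_ (norm≡+‖‖ u) (norm≡+‖‖ v) u≤v)

  diophantine-quadruple-gap : ∀ {a b c d} → a ≢ b → c ≢ d →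
    IsDiophantinePair a b → IsDiophantinePair a c → IsDiophantinePair a d →
    IsDiophantinePair b c → IsDiophantinePair b d → IsDiophantinePair c d →
    norm a ℤ.≤ norm b → norm b ℤ.≤ norm c → norm c ℤ.≤ norm d →
    norm a ℤ.* norm b ℤ.≤ + 64 ℤ.* norm d
  diophantine-quadruple-gap {a} {b} {c} {d} a≢b c≢d ab ac ad bc bd cd a≤b′ b≤c′ c≤d′ =
    subst₂ ℤ._≤_
      (trans (ℤ.pos-* (‖ a ‖) (‖ b ‖)) (sym (cong₂ ℤ._*_ (norm≡+‖‖ a) (norm≡+‖‖ b))))
      (trans (ℤ.pos-* 64 (‖ d ‖)) (sym (cong (λ z → + 64 ℤ.* z) (norm≡+‖‖ d))))
      (ℤ.+≤+ ‖a‖‖b‖≤64‖d‖)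
    where
    a≤b : ‖ a ‖ ≤ ‖ b ‖
    a≤b = norm≤norm⇒‖‖≤‖‖ a b a≤b′
    b≤c : ‖ b ‖ ≤ ‖ c ‖
    b≤c = norm≤norm⇒‖‖≤‖‖ b c b≤c′
    c≤d : ‖ c ‖ ≤ ‖ d ‖
    c≤d = norm≤norm⇒‖‖≤‖‖ c d c≤d′
    a≤c : ‖ a ‖ ≤ ‖ c ‖
    a≤c = ≤-trans a≤b b≤c
    b≤d : ‖ b ‖ ≤ ‖ d ‖
    b≤d = ≤-trans b≤c c≤d
    a≤d : ‖ a ‖ ≤ ‖ d ‖
    a≤d = ≤-trans a≤c c≤d
    ‖a‖‖b‖≤64‖d‖ : ‖ a ‖ * ‖ b ‖ ≤ 64 * ‖ d ‖
    ‖a‖‖b‖≤64‖d‖ = decidable-stable (‖ a ‖ * ‖ b ‖ ≤? 64 * ‖ d ‖) λ no-gap →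
      let gap : 64 * ‖ d ‖ < ‖ a ‖ * ‖ b ‖
          gap = ≰⇒> no-gap in
      regular-quadruple-absurd a≢b c≢d
        (diophantine-triple-regular a≤c b≤c (≤-<-trans (*-monoʳ-≤ 64 c≤d) gap) ab ac bc)
        (diophantine-triple-regular a≤d b≤d gap ab ad bd)
        (diophantine-triple-regular a≤d c≤d (<-≤-trans gap (*-monoʳ-≤ (‖ a ‖) b≤c)) ac ad cd)
        (diophantine-triple-regular b≤d c≤d (<-≤-trans gap (*-mono-≤ a≤b b≤c)) bc bd cd)

open import Data.Nat using (NonZero; _%_; _/_; s≤s; z≤n)
open import Data.Nat.Properties using (+-suc)
open import Data.Nat.DivMod using (m%n≤m; m≥n⇒m/n>0)
open import Data.Integer using (_≤_; _*_; _-_; +≤+)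
import Data.Integer.Properties as ℤ
open import Data.Product using (_×_)

discriminant-positive : ∀ m → NonZero m → ∃ λ k → + 4 * normω m - traceω m * traceω m ≡ +[1+ k ]
discriminant-positive (suc m) _ with suc m % 4 in eq
... | 0 = _ , refl
... | 1 = _ , refl
... | 2 = _ , refl
... | 3 with suc (suc m) / 4 | m≥n⇒m/n>0 {suc (suc m)} {4}
                                  (s≤s (subst (ℕ._≤ suc m) eq (m%n≤m (suc m) 4)))
...   | suc q | _ = _ , cong +_ (+-suc q _)
discriminant-positive (suc m) _ | suc (suc (suc (suc _))) = _ , refl

DProp⇒IsDiophantinePair : ∀ m {u v} → DProp m u v →
  QuadraticRing.IsDiophantinePair (traceω m) (normω m) u v
DProp⇒IsDiophantinePair m {u} {v} (w , w²) = w , (begin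
  w *ᵒ w                 ≡⟨ *ᵒ-definition w w ⟩
  mulO m w w             ≡⟨ w² ⟩
  addO (mulO m u v) oneO ≡⟨ cong (λ z → addO z oneO) (*ᵒ-definition u v) ⟨
  addO (u *ᵒ v) oneO     ≡⟨ +ᵒ-definition (u *ᵒ v) 1ᵒ ⟨
  u *ᵒ v +ᵒ 1ᵒ           ∎)
  where
  open QuadraticRing (traceω m) (normω m)
  open ≡-Reasoning

lemma7 : (m : ℕ) → NonZero m → SquareFree m →
    (a b c d : OK) → DiophantineQuadruple m a b c d →
    (+ 4) ≤ NormO m a → NormO m a ≤ NormO m b →
    NormO m b ≤ NormO m c → NormO m c ≤ NormO m d →
    ((NormO m a * NormO m b) ≤ (+ 64) * NormO m d) ×
    ((NormO m a * NormO m a) ≤ NormO m a * NormO m b)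
lemma7 m m≢0 _ a b c d ((a≢b , _ , _ , _ , _ , c≢d) , (ab , ac , ad , bc , bd , cd)) 4≤a a≤b b≤c c≤d
  with discriminant-positive m m≢0
... | k , disc =
  PositiveDefinite.diophantine-quadruple-gap (traceω m) (normω m) k disc a≢b c≢d
    (pair ab) (pair ac) (pair ad) (pair bc) (pair bd) (pair cd) a≤b b≤c c≤d ,
  ℤ.*-monoˡ-≤-nonNeg (NormO m a) {{ℤ.nonNegative (ℤ.≤-trans (+≤+ z≤n) 4≤a)}} a≤b
  where
  pair : ∀ {u v} → DProp m u v → QuadraticRing.IsDiophantinePair (traceω m) (normω m) u v
  pair = DProp⇒IsDiophantinePair m
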